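{- Let $\#$ be a parametrized monad on a category $\mathbf{C}$ with finite coproducts such that for every object $X$ a final coalgebra $\mathsf{out}_X:\Phi X\to X\#\Phi X$ of $X\#(-)$ exists. For every $e:X\to B\#X$ and $g:B\to C$, \[\Phi g\circ\mathrm{coit}\,e=\mathrm{coit}((g\#\mathrm{id}_X)\circ e),\] where $\mathrm{coit}\,e$ denotes the unique coalgebra morphism from $(X,e)$ to the final coalgebra.
   Context: A parametrized monad is a bifunctor $\#$ such that each $(-)\#X$ is a monad with unit $u^X_A:A\to A\#X$ and multiplication $m^X_A:(A\#X)\#X\to A\#X$, and for each $f:X\to Y$ the family $(\mathrm{id}_Z\#f)_Z$ is a monad morphism. $\Phi$ is a monad with unit $\eta^\nu_X=\mathsf{out}_X^{ -1}\circ u^{\Phi X}_X$ and Kleisli lifting: for $h:X\to\Phi Y$, $h^*:\Phi X\to\Phi Y$ is the unique morphism with $\mathsf{out}_Y\circ h^*=m^{\Phi Y}_Y\circ((\mathsf{out}_Y\circ h)\# h^*)\circ\mathsf{out}_X$. Its action on morphisms is $\Phi g=(\eta^\nu_C\circ g)^*$. -}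

module Defs where

open import Level using (Level; _⊔_) renaming (suc to lsuc)
open import Relation.Binary using (Rel; IsEquivalence)

record Category (o ℓ e : Level) : Set (lsuc (o ⊔ ℓ ⊔ e)) where
  infixr 9 _∘_
  infix  4 _≈_
  infixr 5 _⇒_
  field
    Obj  : Set o
    _⇒_  : Obj → Obj → Set ℓ
    _≈_  : ∀ {A B} → Rel (A ⇒ B) e
    id   : ∀ {A} → A ⇒ A
    _∘_  : ∀ {A B C} → B ⇒ C → A ⇒ B → A ⇒ C
    ≈-equiv   : ∀ {A B} → IsEquivalence (_≈_ {A} {B})
    ∘-resp-≈  : ∀ {A B C} {f g : B ⇒ C} {h i : A ⇒ B} → f ≈ g → h ≈ i → f ∘ h ≈ g ∘ i
    assoc     : ∀ {A B C D} {f : A ⇒ B} {g : B ⇒ C} {h : C ⇒ D} →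
                (h ∘ g) ∘ f ≈ h ∘ (g ∘ f)
    identityˡ : ∀ {A B} {f : A ⇒ B} → id ∘ f ≈ f
    identityʳ : ∀ {A B} {f : A ⇒ B} → f ∘ id ≈ f

record FiniteCoproducts {o ℓ e} (𝒞 : Category o ℓ e) : Set (o ⊔ ℓ ⊔ e) where
  open Category 𝒞
  field
    𝟘        : Obj
    ¡        : ∀ {A} → 𝟘 ⇒ A
    ¡-unique : ∀ {A} (f : 𝟘 ⇒ A) → ¡ ≈ f
    _+_      : Obj → Obj → Obj
    i₁       : ∀ {A B} → A ⇒ A + B
    i₂       : ∀ {A B} → B ⇒ A + B
    [_,_]    : ∀ {A B C} → A ⇒ C → B ⇒ C → A + B ⇒ C
    inject₁  : ∀ {A B C} {f : A ⇒ C} {g : B ⇒ C} → [ f , g ] ∘ i₁ ≈ f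
    inject₂  : ∀ {A B C} {f : A ⇒ C} {g : B ⇒ C} → [ f , g ] ∘ i₂ ≈ g
    +-unique : ∀ {A B C} {f : A ⇒ C} {g : B ⇒ C} {h : A + B ⇒ C} →
               h ∘ i₁ ≈ f → h ∘ i₂ ≈ g → [ f , g ] ≈ h

record Bifunctor {o ℓ e} (𝒞 : Category o ℓ e) : Set (o ⊔ ℓ ⊔ e) where
  open Category 𝒞
  infixl 7 _#_ _#₁_
  field
    _#_   : Obj → Obj → Obj
    _#₁_  : ∀ {A B X Y} → A ⇒ B → X ⇒ Y → (A # X) ⇒ (B # Y)
    #-identity : ∀ {A X} → id {A} #₁ id {X} ≈ id
    #-homomorphism : ∀ {A B C X Y Z} {f : A ⇒ B} {f' : B ⇒ C} {g : X ⇒ Y} {g' : Y ⇒ Z} →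
                     (f' ∘ f) #₁ (g' ∘ g) ≈ (f' #₁ g') ∘ (f #₁ g)
    #-resp-≈ : ∀ {A B X Y} {f f' : A ⇒ B} {g g' : X ⇒ Y} → f ≈ f' → g ≈ g' → f #₁ g ≈ f' #₁ g'

-- A parametrized monad: a bifunctor # such that each (-) # X is a monad
-- (functorial action f ↦ f #₁ id) with unit u X and multiplication m X,
-- and for each f : X ⇒ Y the family (id_A #₁ f)_A is a monad morphism.
record ParametrizedMonad {o ℓ e} (𝒞 : Category o ℓ e) : Set (o ⊔ ℓ ⊔ e) where
  open Category 𝒞
  field
    bifunctor : Bifunctor 𝒞
  open Bifunctor bifunctor
  field
    u : ∀ X A → A ⇒ A # X
    m : ∀ X A → (A # X) # X ⇒ A # X
    u-natural : ∀ {X A B} (f : A ⇒ B) → (f #₁ id {X}) ∘ u X A ≈ u X B ∘ f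
    m-natural : ∀ {X A B} (f : A ⇒ B) →
                (f #₁ id {X}) ∘ m X A ≈ m X B ∘ ((f #₁ id {X}) #₁ id {X})
    m-identityˡ : ∀ {X A} → m X A ∘ (u X A #₁ id {X}) ≈ id
    m-identityʳ : ∀ {X A} → m X A ∘ u X (A # X) ≈ id
    m-assoc     : ∀ {X A} → m X A ∘ (m X A #₁ id {X}) ≈ m X A ∘ m X (A # X)
    morph-u : ∀ {X Y} (f : X ⇒ Y) A → (id {A} #₁ f) ∘ u X A ≈ u Y A
    morph-m : ∀ {X Y} (f : X ⇒ Y) A →
              (id {A} #₁ f) ∘ m X A ≈ m Y A ∘ ((id {A} #₁ f) #₁ f)

record FinalCoalgebras {o ℓ e} {𝒞 : Category o ℓ e} (T : ParametrizedMonad 𝒞)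
       : Set (o ⊔ ℓ ⊔ e) where
  open Category 𝒞
  open ParametrizedMonad T
  open Bifunctor bifunctor
  field
    Φ    : Obj → Obj
    out  : ∀ X → Φ X ⇒ X # Φ X
    coit : ∀ {X Z} → Z ⇒ X # Z → Z ⇒ Φ X
    coit-commute : ∀ {X Z} (e : Z ⇒ X # Z) → out X ∘ coit e ≈ (id #₁ coit e) ∘ e
    coit-unique  : ∀ {X Z} (e : Z ⇒ X # Z) (h : Z ⇒ Φ X) →
                   out X ∘ h ≈ (id #₁ h) ∘ e → h ≈ coit e

  -- The inverse of out X (Lambek's lemma): coit (id #₁ out X).
  out⁻¹ : ∀ X → X # Φ X ⇒ Φ X
  out⁻¹ X = coit (id #₁ out X)

  η : ∀ X → X ⇒ Φ X
  η X = out⁻¹ X ∘ u (Φ X) X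

  IsKleisliLift : ∀ {X Y} → X ⇒ Φ Y → Φ X ⇒ Φ Y → Set e
  IsKleisliLift {X} {Y} h k = out Y ∘ k ≈ m (Φ Y) Y ∘ (((out Y ∘ h) #₁ k) ∘ out X)

  IsΦ₁ : ∀ {B C} → B ⇒ C → Φ B ⇒ Φ C → Set e
  IsΦ₁ {B} {C} g k = IsKleisliLift (η C ∘ g) k

-- The Kleisli-lifting equation for Φ g = (η ∘ g)* collapses, via out ∘ η = u
-- and the unit law m ∘ (u #₁ id) = id, to out ∘ Φ g = (g #₁ Φ g) ∘ out.
-- Hence Φ g ∘ coit ε is a coalgebra morphism out of (X , (g #₁ id) ∘ ε), and
-- finality identifies it with coit ((g #₁ id) ∘ ε).
module Submission where

open import Defs
open import Relation.Binary using (Setoid; IsEquivalence)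
import Relation.Binary.Reasoning.Setoid as SetoidReasoning

module CategoryReasoning {o ℓ e} (𝒞 : Category o ℓ e) where
  open Category 𝒞

  hom : Obj → Obj → Setoid ℓ e
  hom A B = record { Carrier = A ⇒ B ; _≈_ = _≈_ ; isEquivalence = ≈-equiv }

  module ≈ {A B} = IsEquivalence (≈-equiv {A} {B})

  module HomReasoning {A B : Obj} = SetoidReasoning (hom A B)

  sym-assoc : ∀ {A B C D} {f : A ⇒ B} {g : B ⇒ C} {h : C ⇒ D} → h ∘ (g ∘ f) ≈ (h ∘ g) ∘ f
  sym-assoc = ≈.sym assoc

  refl⟩∘⟨_ : ∀ {A B C} {f : B ⇒ C} {h i : A ⇒ B} → h ≈ i → f ∘ h ≈ f ∘ i
  refl⟩∘⟨ p = ∘-resp-≈ ≈.refl p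

  _⟩∘⟨refl : ∀ {A B C} {f g : B ⇒ C} {h : A ⇒ B} → f ≈ g → f ∘ h ≈ g ∘ h
  p ⟩∘⟨refl = ∘-resp-≈ p ≈.refl

  infixr 4 refl⟩∘⟨_
  infixl 5 _⟩∘⟨refl

module BifunctorProperties {o ℓ e} {𝒞 : Category o ℓ e} (H : Bifunctor 𝒞) where
  open Category 𝒞
  open Bifunctor H
  open CategoryReasoning 𝒞

  #₁-decompose : ∀ {A B X Y} {f : A ⇒ B} {k : X ⇒ Y} → f #₁ k ≈ (id #₁ k) ∘ (f #₁ id)
  #₁-decompose = ≈.trans (#-resp-≈ (≈.sym identityˡ) (≈.sym identityʳ)) #-homomorphism

  #₁-distribˡ : ∀ {A B C X Y} {f : B ⇒ C} {g : A ⇒ B} {k : X ⇒ Y} →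
                (f ∘ g) #₁ k ≈ (f #₁ k) ∘ (g #₁ id)
  #₁-distribˡ = ≈.trans (#-resp-≈ ≈.refl (≈.sym identityʳ)) #-homomorphism

  #₁-absorbʳ : ∀ {A B X Y Z} {f : A ⇒ B} {k : Y ⇒ Z} {h : X ⇒ Y} →
               (f #₁ k) ∘ (id #₁ h) ≈ f #₁ (k ∘ h)
  #₁-absorbʳ = ≈.trans (≈.sym #-homomorphism) (#-resp-≈ identityʳ ≈.refl)

module ParametrizedMonadProperties {o ℓ e} {𝒞 : Category o ℓ e} (T : ParametrizedMonad 𝒞) where
  open Category 𝒞
  open ParametrizedMonad T
  open Bifunctor bifunctor
  open BifunctorProperties bifunctor
  open CategoryReasoning 𝒞

  m∘u#₁≈id#₁ : ∀ {X Y A} (k : Y ⇒ X) → m X A ∘ (u X A #₁ k) ≈ id #₁ k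
  m∘u#₁≈id#₁ k = begin
    m _ _ ∘ (u _ _ #₁ k)               ≈⟨ refl⟩∘⟨ ≈.trans (#-resp-≈ (≈.sym identityʳ) (≈.sym identityˡ)) #-homomorphism ⟩
    m _ _ ∘ ((u _ _ #₁ id) ∘ (id #₁ k)) ≈⟨ sym-assoc ⟩
    (m _ _ ∘ (u _ _ #₁ id)) ∘ (id #₁ k) ≈⟨ m-identityˡ ⟩∘⟨refl ⟩
    id ∘ (id #₁ k)                      ≈⟨ identityˡ ⟩
    id #₁ k                             ∎
    where open HomReasoning

module FinalCoalgebraProperties {o ℓ e} {𝒞 : Category o ℓ e} {T : ParametrizedMonad 𝒞}
                                (F : FinalCoalgebras T) where
  open Category 𝒞
  open ParametrizedMonad T
  open Bifunctor bifunctor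
  open FinalCoalgebras F
  open BifunctorProperties bifunctor
  open ParametrizedMonadProperties T
  open CategoryReasoning 𝒞

  coit-out : ∀ {X} → coit (out X) ≈ id
  coit-out {X} = ≈.sym (coit-unique (out X) id
    (≈.trans identityʳ (≈.trans (≈.sym identityˡ) (≈.sym #-identity ⟩∘⟨refl))))

  out⁻¹∘out≈id : ∀ {X} → out⁻¹ X ∘ out X ≈ id
  out⁻¹∘out≈id {X} = ≈.trans (coit-unique (out X) (out⁻¹ X ∘ out X) commute) coit-out
    where
    open HomReasoning
    commute : out X ∘ (out⁻¹ X ∘ out X) ≈ (id #₁ (out⁻¹ X ∘ out X)) ∘ out X
    commute = begin
      out X ∘ (out⁻¹ X ∘ out X)                ≈⟨ sym-assoc ⟩
      (out X ∘ out⁻¹ X) ∘ out X                ≈⟨ coit-commute (id #₁ out X) ⟩∘⟨refl ⟩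
      ((id #₁ out⁻¹ X) ∘ (id #₁ out X)) ∘ out X ≈⟨ #₁-absorbʳ ⟩∘⟨refl ⟩
      (id #₁ (out⁻¹ X ∘ out X)) ∘ out X         ∎

  out∘out⁻¹≈id : ∀ {X} → out X ∘ out⁻¹ X ≈ id
  out∘out⁻¹≈id {X} = begin
    out X ∘ out⁻¹ X                 ≈⟨ coit-commute (id #₁ out X) ⟩
    (id #₁ out⁻¹ X) ∘ (id #₁ out X) ≈⟨ #₁-absorbʳ ⟩
    id #₁ (out⁻¹ X ∘ out X)         ≈⟨ #-resp-≈ ≈.refl out⁻¹∘out≈id ⟩
    id #₁ id                        ≈⟨ #-identity ⟩
    id                              ∎
    where open HomReasoning

  out∘η≈u : ∀ {X} → out X ∘ η X ≈ u (Φ X) X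
  out∘η≈u = ≈.trans sym-assoc (≈.trans (out∘out⁻¹≈id ⟩∘⟨refl) identityˡ)

  out∘Φ₁ : ∀ {B C} {g : B ⇒ C} {Φg : Φ B ⇒ Φ C} → IsΦ₁ g Φg →
           out C ∘ Φg ≈ (g #₁ Φg) ∘ out B
  out∘Φ₁ {B} {C} {g} {Φg} isΦ₁ = begin
    out C ∘ Φg                                          ≈⟨ isΦ₁ ⟩
    m (Φ C) C ∘ (((out C ∘ (η C ∘ g)) #₁ Φg) ∘ out B)   ≈⟨ refl⟩∘⟨ #-resp-≈ out∘η∘g ≈.refl ⟩∘⟨refl ⟩
    m (Φ C) C ∘ (((u (Φ C) C ∘ g) #₁ Φg) ∘ out B)       ≈⟨ refl⟩∘⟨ ≈.trans (#₁-distribˡ ⟩∘⟨refl) assoc ⟩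
    m (Φ C) C ∘ ((u (Φ C) C #₁ Φg) ∘ ((g #₁ id) ∘ out B)) ≈⟨ sym-assoc ⟩
    (m (Φ C) C ∘ (u (Φ C) C #₁ Φg)) ∘ ((g #₁ id) ∘ out B) ≈⟨ m∘u#₁≈id#₁ Φg ⟩∘⟨refl ⟩
    (id #₁ Φg) ∘ ((g #₁ id) ∘ out B)                      ≈⟨ sym-assoc ⟩
    ((id #₁ Φg) ∘ (g #₁ id)) ∘ out B                      ≈⟨ ≈.sym #₁-decompose ⟩∘⟨refl ⟩
    (g #₁ Φg) ∘ out B                                     ∎
    where
    open HomReasoning
    out∘η∘g : out C ∘ (η C ∘ g) ≈ u (Φ C) C ∘ g
    out∘η∘g = ≈.trans sym-assoc (out∘η≈u ⟩∘⟨refl)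

  Φ₁∘coit : ∀ {X B C} (ε : X ⇒ B # X) (g : B ⇒ C) (Φg : Φ B ⇒ Φ C) → IsΦ₁ g Φg →
            Φg ∘ coit ε ≈ coit ((g #₁ id {X}) ∘ ε)
  Φ₁∘coit {X} {B} {C} ε g Φg isΦ₁ = coit-unique ((g #₁ id) ∘ ε) (Φg ∘ coit ε) (begin
    out C ∘ (Φg ∘ coit ε)                  ≈⟨ sym-assoc ⟩
    (out C ∘ Φg) ∘ coit ε                  ≈⟨ out∘Φ₁ isΦ₁ ⟩∘⟨refl ⟩
    ((g #₁ Φg) ∘ out B) ∘ coit ε           ≈⟨ assoc ⟩
    (g #₁ Φg) ∘ (out B ∘ coit ε)           ≈⟨ refl⟩∘⟨ coit-commute ε ⟩
    (g #₁ Φg) ∘ ((id #₁ coit ε) ∘ ε)       ≈⟨ sym-assoc ⟩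
    ((g #₁ Φg) ∘ (id #₁ coit ε)) ∘ ε       ≈⟨ ≈.trans #₁-absorbʳ #₁-decompose ⟩∘⟨refl ⟩
    ((id #₁ (Φg ∘ coit ε)) ∘ (g #₁ id)) ∘ ε ≈⟨ assoc ⟩
    (id #₁ (Φg ∘ coit ε)) ∘ ((g #₁ id) ∘ ε) ∎)
    where open HomReasoning

lemma4p20 : ∀ {o ℓ e} (𝒞 : Category o ℓ e) (cop : FiniteCoproducts 𝒞) (T : ParametrizedMonad 𝒞) (F : FinalCoalgebras T) →
    let open Category 𝒞 in
    let open ParametrizedMonad T in
    let open Bifunctor bifunctor in
    let open FinalCoalgebras F in
    ∀ {X B C} (ε : X ⇒ B # X) (g : B ⇒ C) (Φg : Φ B ⇒ Φ C) → IsΦ₁ g Φg →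
    Φg ∘ coit ε ≈ coit ((g #₁ id {X}) ∘ ε)
lemma4p20 𝒞 _ T F = FinalCoalgebraProperties.Φ₁∘coit F
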